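{- Let $\mathbf{P}=(X,P)$ be a dually-CPT poset whose comparability graph $G_{\mathbf{P}}$ is connected. Then the quotient poset $\mathbf{P}/\mathcal{M}(\mathbf{P})$ is dually-CPT and every maximal strong module $M$ of $\mathbf{P}$ induces a CI subposet $\mathbf{P}(M)$. In particular, if the quotient poset is CI, then $\mathbf{P}$ is CI.
   Context: A poset $\mathbf{P}=(X,P)$ (finite) is CPT if there is a tree $T$ and paths $W_x$ ($x\in X$) of $T$ with $x<y$ iff $W_x\subsetneq W_y$; it is CI if such a representation exists with $T$ a path. $\mathbf{P}$ is dually-CPT if $\mathbf{P}$ and its dual $\mathbf{P}^d$ (reversed order) are both CPT. The comparability graph $G_{\mathbf{P}}$ has vertex set $X$, with $xy$ an edge iff $x\ne y$ are comparable. A module of $\mathbf{P}$ is a set $M\subseteq X$ such that every $y\in X\setminus M$ is either comparable to all elements of $M$ or incomparable to all elements of $M$. A module $M$ is strong if for every module $M'$, $M\cap M'=\emptyset$ or $M\subseteq M'$ or $M'\subseteq M$. A maximal strong module is a strong module $M\ne X$ not properly contained in any strong module other than $X$. For $|X|\ge 2$ the maximal strong modules form a partition $\mathcal{M}(\mathbf{P})=\{M_1,\dots,M_k\}$ of $X$ (the maximal modular partition). The quotient poset $\mathbf{P}/\mathcal{M}(\mathbf{P})$ has one vertex $v_i$ per part $M_i$, realized as the subposet of $\mathbf{P}$ induced by one representative element from each $M_i$ (so $v_i,v_j$ are comparable iff every element of $M_i$ is comparable to every element of $M_j$). $\mathbf{P}(M)$ denotes the subposet induced by $M$. -}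

module Defs where

open import Data.Nat using (ℕ; suc)
open import Data.Fin using (Fin; toℕ)
open import Data.Fin.Subset as Sub using (Subset; Nonempty)
open import Data.List using (List; head; last)
open import Data.List.Membership.Propositional as LM using ()
open import Data.List.Relation.Unary.Linked using (Linked)
open import Data.List.Relation.Unary.Unique.Propositional using (Unique)
open import Data.Maybe using (just)
open import Data.Product using (Σ; ∃; _×_; _,_; proj₁)
open import Data.Sum using (_⊎_)
open import Relation.Nullary using (¬_)
open import Relation.Binary.PropositionalEquality using (_≡_)
open import Relation.Binary.Construct.Closure.ReflexiveTransitive using (Star)

record FinPoset : Set₁ where
  field
    size    : ℕ
    _≺_     : Fin size → Fin size → Set
    irrefl  : ∀ x → ¬ (x ≺ x)
    trans   : ∀ {x y z} → x ≺ y → y ≺ z → x ≺ z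

IsPathFromTo : ∀ {m} → (Fin m → Fin m → Set) → Fin m → Fin m → List (Fin m) → Set
IsPathFromTo E u v ps =
  Linked E ps × Unique ps × head ps ≡ just u × last ps ≡ just v

IsPath : ∀ {m} → (Fin m → Fin m → Set) → List (Fin m) → Set
IsPath E ps = ∃ λ u → ∃ λ v → IsPathFromTo E u v ps

record IsTree {m : ℕ} (E : Fin m → Fin m → Set) : Set where
  field
    sym     : ∀ {u v} → E u v → E v u
    irrefl  : ∀ u → ¬ E u u
    exists  : ∀ u v → ∃ λ ps → IsPathFromTo E u v ps
    unique  : ∀ u v ps qs → IsPathFromTo E u v ps → IsPathFromTo E u v qs → ps ≡ qs

PathGraph : ∀ m → Fin m → Fin m → Set
PathGraph m i j = suc (toℕ i) ≡ toℕ j ⊎ suc (toℕ j) ≡ toℕ i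

_⊊ₗ_ : ∀ {m} → List (Fin m) → List (Fin m) → Set
W ⊊ₗ W' = (∀ v → v LM.∈ W → v LM.∈ W') × (∃ λ v → v LM.∈ W' × ¬ (v LM.∈ W))

PathRep : ∀ {A : Set} → (A → A → Set) → ∀ m → (Fin m → Fin m → Set) → Set
PathRep {A} _<_ m E =
  Σ (A → List (Fin m)) λ W →
    (∀ x → IsPath E (W x)) × (∀ x y → (x < y → W x ⊊ₗ W y) × (W x ⊊ₗ W y → x < y))

CPT : ∀ {A : Set} → (A → A → Set) → Set₁
CPT _<_ = ∃ λ m → Σ (Fin m → Fin m → Set) λ E → IsTree E × PathRep _<_ m E

-- CI: containment of intervals, i.e. paths in a tree that is a path
CI : ∀ {A : Set} → (A → A → Set) → Set
CI _<_ = ∃ λ m → PathRep _<_ m (PathGraph m)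

flip' : ∀ {A : Set} → (A → A → Set) → (A → A → Set)
flip' R x y = R y x

DuallyCPT : ∀ {A : Set} → (A → A → Set) → Set₁
DuallyCPT R = CPT R × CPT (flip' R)

module _ (P : FinPoset) where
  open FinPoset P

  Comparable : Fin size → Fin size → Set
  Comparable x y = x ≺ y ⊎ y ≺ x

  ComparabilityConnected : Set
  ComparabilityConnected = ∀ x y → Star Comparable x y

  Induced : (S : Subset size) → Σ (Fin size) (λ x → x Sub.∈ S) → Σ (Fin size) (λ x → x Sub.∈ S) → Set
  Induced S a b = proj₁ a ≺ proj₁ b

  IsModule : Subset size → Set
  IsModule M = Nonempty M ×
    (∀ y → ¬ (y Sub.∈ M) →
       (∀ z → z Sub.∈ M → Comparable y z) ⊎ (∀ z → z Sub.∈ M → ¬ Comparable y z))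

  IsStrongModule : Subset size → Set
  IsStrongModule M = IsModule M ×
    (∀ M' → IsModule M' → (∀ z → z Sub.∈ M → ¬ (z Sub.∈ M')) ⊎ (M Sub.⊆ M' ⊎ M' Sub.⊆ M))

  IsMaximalStrongModule : Subset size → Set
  IsMaximalStrongModule M = IsStrongModule M × ¬ (M ≡ Sub.⊤) ×
    (∀ M' → IsStrongModule M' → M Sub.⊂ M' → M' ≡ Sub.⊤)

  -- R picks exactly one representative from each part of the maximal
  -- modular partition (and nothing else); P(R) is then the quotient P/M(P)
  IsQuotientRepresentatives : Subset size → Set
  IsQuotientRepresentatives R =
    (∀ r → r Sub.∈ R → ∃ λ M → IsMaximalStrongModule M × r Sub.∈ M) ×
    (∀ M → IsMaximalStrongModule M →
       (∃ λ r → r Sub.∈ R × r Sub.∈ M) ×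
       (∀ r r' → r Sub.∈ R → r Sub.∈ M → r' Sub.∈ R → r' Sub.∈ M → r ≡ r'))

{-# OPTIONS --safe #-}
-- Restricting a path representation to a subposet leaves a path representation, which settles the quotient.
-- A maximal strong module M ≠ X of a connected poset has an outside element y comparable to all of M, and
-- strongness puts all of M on the same side of y, say below it.  Then the paths of M lie inside the tree
-- path of y, which is itself a path, so P(M) is CI (when M lies above y, use the dual representation).
-- Finally, interval representations of the quotient and of the modules are combined lexicographically:
-- each element gets the interval of its module in the quotient, refined by its interval inside the module.
module Submission where

open import Defs
open import Data.Bool.Properties as Boolₚ using ()
open import Data.Nat using (ℕ; zero; suc; _≤_; _<_; _+_; _*_; _∸_; _⊓_; _⊔_; s≤s; z≤n; _≤?_; _<?_)
import Data.Nat.Properties as ℕₚ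
open import Data.Fin using (Fin; toℕ; fromℕ<; zero; suc)
open import Data.Fin.Properties using (toℕ-fromℕ<; toℕ-injective; toℕ<n; any?; all?) renaming (_≟_ to _≟ᶠ_)
open import Data.Fin.Subset using (Subset; ⁅_⁆; ⊤; _⊆_; _⊃_) renaming (_∈_ to _∈ₛ_; _∉_ to _∉ₛ_)
open import Data.Fin.Subset.Properties using (_⊂?_; anySubset?; nonempty?; ∈⊤; x∈⁅x⁆; x∈⁅y⁆⇒x≡y; ⊆-antisym)
  renaming (_∈?_ to _∈ₛ?_; _⊆?_ to _⊆ₛ?_)
open import Data.Fin.Subset.Induction using (Acc; acc; ⊃-wellFounded)
open import Data.List using (List; []; _∷_; head; last; map; length)
open import Data.List.Properties using (head-map; last-map)
open import Data.List.Membership.Propositional using (_∈_; find; lose)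
open import Data.List.Membership.Propositional.Properties using (∈-map⁺; ∈-map⁻)
import Data.List.Membership.DecPropositional as DecMembership
import Data.List.Relation.Binary.Subset.DecPropositional as DecSubset
open import Data.List.Relation.Unary.Any using (here; there) renaming (any? to anyₗ?)
open import Data.List.Relation.Unary.All as All using (All; []; _∷_)
open import Data.List.Relation.Unary.AllPairs using ([]; _∷_)
open import Data.List.Relation.Unary.Linked as Linked using (Linked; []; [-]; _∷_)
open import Data.List.Relation.Unary.Unique.Propositional using (Unique)
import Data.Maybe as Maybe
open import Data.Maybe using (just)
open import Data.Vec using (tabulate)
open import Data.Vec.Properties using (lookup∘tabulate; lookup⇒[]=; []=⇒lookup; ≡-dec)
open import Data.Product using (Σ; ∃; _×_; _,_; proj₁; proj₂)
open import Data.Sum using (_⊎_; inj₁; inj₂; [_,_])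
open import Data.Empty using (⊥; ⊥-elim)
open import Function using (_∘_; id)
open import Function.Bundles using (_⇔_; mk⇔; module Equivalence)
open import Function.Construct.Composition using (_⇔-∘_)
open import Relation.Binary using (Decidable)
open import Relation.Binary.Construct.Closure.ReflexiveTransitive using (Star; ε; _◅_)
open import Relation.Nullary using (¬_; Dec; yes; no; does)
open import Relation.Nullary.Decidable using (dec-true; _×-dec_; _⊎-dec_; _→-dec_; ¬?; map′; decidable-stable)
open import Relation.Binary.PropositionalEquality using (_≡_; _≢_; refl; sym; trans; cong; cong₂; subst)

module _ {m : ℕ} where
  open DecMembership (_≟ᶠ_ {m}) using (_∈?_)
  open DecSubset (_≟ᶠ_ {m}) using (_⊆?_)

  _⊊ₗ?_ : (xs ys : List (Fin m)) → Dec (xs ⊊ₗ ys)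
  xs ⊊ₗ? ys = map′ (λ xs⊆ys v → xs⊆ys {v}) (λ xs⊆ys {v} → xs⊆ys v) (xs ⊆? ys) ×-dec new?
    where
    new? : Dec (∃ λ v → v ∈ ys × ¬ v ∈ xs)
    new? = map′ (λ v∈ys∖xs → find v∈ys∖xs) (λ (v , v∈ys , v∉xs) → lose v∈ys v∉xs)
                (anyₗ? (λ v → ¬? (v ∈? xs)) ys)

PathRep-dec : ∀ {A : Set} {R : A → A → Set} {m E} → PathRep R m E → Decidable R
PathRep-dec (W , _ , represents) x y =
  map′ (proj₂ (represents x y)) (proj₁ (represents x y)) (W x ⊊ₗ? W y)

CPT-dec : ∀ {A : Set} {R : A → A → Set} → CPT R → Decidable R
CPT-dec (_ , _ , _ , rep) = PathRep-dec rep

PathRep-restrict : ∀ {A B : Set} {R : A → A → Set} {m E} (f : B → A) →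
  PathRep R m E → PathRep (λ a b → R (f a) (f b)) m E
PathRep-restrict f (W , isPath , represents) = W ∘ f , isPath ∘ f , λ x y → represents (f x) (f y)

CPT-restrict : ∀ {A B : Set} {R : A → A → Set} (f : B → A) → CPT R → CPT (λ a b → R (f a) (f b))
CPT-restrict f (m , E , tree , rep) = m , E , tree , PathRep-restrict f rep

CI-restrict : ∀ {A B : Set} {R : A → A → Set} (f : B → A) → CI R → CI (λ a b → R (f a) (f b))
CI-restrict f (m , rep) = m , PathRep-restrict f rep

DuallyCPT-restrict : ∀ {A B : Set} {R : A → A → Set} (f : B → A) →
  DuallyCPT R → DuallyCPT (λ a b → R (f a) (f b))
DuallyCPT-restrict f (cpt , cptᵈ) = CPT-restrict f cpt , CPT-restrict f cptᵈ

infix 4 _⊊ᵢ_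
_⊊ᵢ_ : ℕ × ℕ → ℕ × ℕ → Set
(a , b) ⊊ᵢ (c , d) = c ≤ a × b ≤ d × (c < a ⊎ b < d)

record IntervalRep {A : Set} (R : A → A → Set) : Set where
  field
    bound       : ℕ
    left right  : A → ℕ
    left≤right  : ∀ x → left x ≤ right x
    right<bound : ∀ x → right x < bound
    sound       : ∀ {x y} → R x y → (left x , right x) ⊊ᵢ (left y , right y)
    complete    : ∀ {x y} → (left x , right x) ⊊ᵢ (left y , right y) → R x y

IntervalRep-dual : ∀ {A : Set} {R : A → A → Set} → IntervalRep R → IntervalRep (flip' R)
IntervalRep-dual I = record
  { bound       = bound + bound
  ; left        = right
  ; right       = λ x → bound + left x
  ; left≤right  = λ x → ℕₚ.≤-trans (ℕₚ.<⇒≤ (right<bound x)) (ℕₚ.m≤m+n bound (left x))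
  ; right<bound = λ x → ℕₚ.+-monoʳ-< bound (ℕₚ.≤-<-trans (left≤right x) (right<bound x))
  ; sound       = reflect ∘ sound
  ; complete    = complete ∘ reflect⁻¹
  }
  where
  open IntervalRep I
  reflect : ∀ {a b c d} → (a , b) ⊊ᵢ (c , d) → (d , bound + c) ⊊ᵢ (b , bound + a)
  reflect (c≤a , b≤d , inj₁ c<a) = b≤d , ℕₚ.+-monoʳ-≤ bound c≤a , inj₂ (ℕₚ.+-monoʳ-< bound c<a)
  reflect (c≤a , b≤d , inj₂ b<d) = b≤d , ℕₚ.+-monoʳ-≤ bound c≤a , inj₁ b<d
  reflect⁻¹ : ∀ {a b c d} → (d , bound + c) ⊊ᵢ (b , bound + a) → (a , b) ⊊ᵢ (c , d)
  reflect⁻¹ (b≤d , a≤c , inj₁ b<d) = ℕₚ.+-cancelˡ-≤ bound _ _ a≤c , b≤d , inj₂ b<d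
  reflect⁻¹ (b≤d , a≤c , inj₂ a<c) = ℕₚ.+-cancelˡ-≤ bound _ _ a≤c , b≤d , inj₁ (ℕₚ.+-cancelˡ-< bound _ _ a<c)

module _ {m : ℕ} where

  IsSegment : List (Fin m) → ℕ × ℕ → Set
  IsSegment xs (a , b) = ∀ v → (v ∈ xs → a ≤ toℕ v × toℕ v ≤ b) × (a ≤ toℕ v → toℕ v ≤ b → v ∈ xs)

  private
    vertex : ∀ k → k < m → Σ (Fin m) λ v → toℕ v ≡ k
    vertex k k<m = fromℕ< k<m , toℕ-fromℕ< k<m

  ⊊ₗ⇒⊊ᵢ : ∀ {xs ys a b c d} → IsSegment xs (a , b) → IsSegment ys (c , d) → a ≤ b → b < m →
          xs ⊊ₗ ys → (a , b) ⊊ᵢ (c , d)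
  ⊊ₗ⇒⊊ᵢ {xs} {ys} {a} {b} {c} {d} xs≈ ys≈ a≤b b<m (xs⊆ys , w , w∈ys , w∉xs) = c≤a , b≤d , strict
    where
    inYs : ∀ {k} → a ≤ k → k ≤ b → k < m → c ≤ k × k ≤ d
    inYs {k} a≤k k≤b k<m with vertex k k<m
    ... | v , refl = proj₁ (ys≈ v) (xs⊆ys v (proj₂ (xs≈ v) a≤k k≤b))
    c≤a : c ≤ a
    c≤a = proj₁ (inYs ℕₚ.≤-refl a≤b (ℕₚ.≤-<-trans a≤b b<m))
    b≤d : b ≤ d
    b≤d = proj₂ (inYs a≤b ℕₚ.≤-refl b<m)
    strict : c < a ⊎ b < d
    strict with a ≤? toℕ w | toℕ w ≤? b
    ... | no a≰w | _       = inj₁ (ℕₚ.≤-<-trans (proj₁ (proj₁ (ys≈ w) w∈ys)) (ℕₚ.≰⇒> a≰w))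
    ... | yes a≤w | yes w≤b = ⊥-elim (w∉xs (proj₂ (xs≈ w) a≤w w≤b))
    ... | yes _ | no w≰b   = inj₂ (ℕₚ.<-≤-trans (ℕₚ.≰⇒> w≰b) (proj₂ (proj₁ (ys≈ w) w∈ys)))

  ⊊ᵢ⇒⊊ₗ : ∀ {xs ys a b c d} → IsSegment xs (a , b) → IsSegment ys (c , d) → c ≤ d → d < m →
          (a , b) ⊊ᵢ (c , d) → xs ⊊ₗ ys
  ⊊ᵢ⇒⊊ₗ {xs} {ys} {a} {b} {c} {d} xs≈ ys≈ c≤d d<m (c≤a , b≤d , strict) = xs⊆ys , new strict
    where
    xs⊆ys : ∀ v → v ∈ xs → v ∈ ys
    xs⊆ys v v∈xs = let (a≤v , v≤b) = proj₁ (xs≈ v) v∈xs in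
      proj₂ (ys≈ v) (ℕₚ.≤-trans c≤a a≤v) (ℕₚ.≤-trans v≤b b≤d)
    new : c < a ⊎ b < d → ∃ λ v → v ∈ ys × ¬ v ∈ xs
    new (inj₁ c<a) with vertex c (ℕₚ.≤-<-trans c≤d d<m)
    ... | v , refl = v , proj₂ (ys≈ v) ℕₚ.≤-refl c≤d ,
                     λ v∈xs → ℕₚ.<-irrefl refl (ℕₚ.<-≤-trans c<a (proj₁ (proj₁ (xs≈ v) v∈xs)))
    new (inj₂ b<d) with vertex d d<m
    ... | v , refl = v , proj₂ (ys≈ v) c≤d ℕₚ.≤-refl ,
                     λ v∈xs → ℕₚ.<-irrefl refl (ℕₚ.<-≤-trans b<d (proj₂ (proj₁ (xs≈ v) v∈xs)))

  segment : (a k : ℕ) → a + k < m → List (Fin m)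
  segment a zero    a<m   = fromℕ< (ℕₚ.≤-<-trans (ℕₚ.m≤m+n a 0) a<m) ∷ []
  segment a (suc k) a+k<m =
    fromℕ< (ℕₚ.≤-<-trans (ℕₚ.m≤m+n a (suc k)) a+k<m) ∷ segment (suc a) k (subst (_< m) (ℕₚ.+-suc a k) a+k<m)

  segment-isSegment : ∀ a k a+k<m → IsSegment (segment a k a+k<m) (a , a + k)
  segment-isSegment a zero a<m v = members , collect
    where
    members : v ∈ segment a zero a<m → a ≤ toℕ v × toℕ v ≤ a + 0
    members (here refl) = ℕₚ.≤-reflexive (sym (toℕ-fromℕ< _)) ,
                          ℕₚ.≤-trans (ℕₚ.≤-reflexive (toℕ-fromℕ< _)) (ℕₚ.m≤m+n a 0)
    collect : a ≤ toℕ v → toℕ v ≤ a + 0 → v ∈ segment a zero a<m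
    collect a≤v v≤a+0 = here (toℕ-injective (trans v≡a (sym (toℕ-fromℕ< _))))
      where
      v≡a : toℕ v ≡ a
      v≡a = ℕₚ.≤-antisym (subst (toℕ v ≤_) (ℕₚ.+-identityʳ a) v≤a+0) a≤v
  segment-isSegment a (suc k) a+k<m v = members , collect
    where
    tail-isSegment : IsSegment (segment (suc a) k _) (suc a , suc a + k)
    tail-isSegment = segment-isSegment (suc a) k (subst (_< m) (ℕₚ.+-suc a k) a+k<m)
    members : v ∈ segment a (suc k) a+k<m → a ≤ toℕ v × toℕ v ≤ a + suc k
    members (here refl) = ℕₚ.≤-reflexive (sym (toℕ-fromℕ< _)) ,
                          ℕₚ.≤-trans (ℕₚ.≤-reflexive (toℕ-fromℕ< _)) (ℕₚ.m≤m+n a (suc k))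
    members (there v∈) = let (a<v , v≤) = proj₁ (tail-isSegment v) v∈ in
                         ℕₚ.<⇒≤ a<v , subst (toℕ v ≤_) (sym (ℕₚ.+-suc a k)) v≤
    collect : a ≤ toℕ v → toℕ v ≤ a + suc k → v ∈ segment a (suc k) a+k<m
    collect a≤v v≤ with a ℕₚ.≟ toℕ v
    ... | yes a≡v = here (toℕ-injective (trans (sym a≡v) (sym (toℕ-fromℕ< _))))
    ... | no a≢v = there (proj₂ (tail-isSegment v) (ℕₚ.≤∧≢⇒< a≤v a≢v) (subst (toℕ v ≤_) (ℕₚ.+-suc a k) v≤))

  segment-isPath : ∀ a k a+k<m → IsPath (PathGraph m) (segment a k a+k<m)
  segment-isPath a k a+k<m =
    proj₁ (starts k) , proj₁ (ends a k a+k<m) , linked a k a+k<m , unique a k a+k<m ,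
    proj₂ (starts k) , proj₂ (ends a k a+k<m)
    where
    starts : ∀ k {a+k<m} → ∃ λ v → head (segment a k a+k<m) ≡ just v
    starts zero    = _ , refl
    starts (suc k) = _ , refl
    ends : ∀ a k a+k<m → ∃ λ v → last (segment a k a+k<m) ≡ just v
    ends a zero          _ = _ , refl
    ends a (suc zero)    _ = _ , refl
    ends a (suc (suc k)) _ = ends (suc a) (suc k) _
    linked : ∀ a k a+k<m → Linked (PathGraph m) (segment a k a+k<m)
    linked a zero          _ = [-]
    linked a (suc zero)    _ = inj₁ (trans (cong suc (toℕ-fromℕ< _)) (sym (toℕ-fromℕ< _))) ∷ [-]
    linked a (suc (suc k)) _ = inj₁ (trans (cong suc (toℕ-fromℕ< _)) (sym (toℕ-fromℕ< _))) ∷ linked (suc a) (suc k) _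
    unique : ∀ a k a+k<m → Unique (segment a k a+k<m)
    unique a zero    _ = [] ∷ []
    unique a (suc k) _ = All.tabulate (λ {v} v∈ a≡v → ℕₚ.<-irrefl (trans (sym (toℕ-fromℕ< _)) (cong toℕ a≡v))
                                         (proj₁ (proj₁ (segment-isSegment (suc a) k _ v) v∈)))
                         ∷ unique (suc a) k _

  private
    lowest highest : List (Fin m) → ℕ
    lowest []           = 0
    lowest (x ∷ [])     = toℕ x
    lowest (x ∷ y ∷ ys) = toℕ x ⊓ lowest (y ∷ ys)
    highest []           = 0
    highest (x ∷ [])     = toℕ x
    highest (x ∷ y ∷ ys) = toℕ x ⊔ highest (y ∷ ys)

    lowest≤ : ∀ {v} xs → v ∈ xs → lowest xs ≤ toℕ v
    lowest≤ (x ∷ [])     (here refl) = ℕₚ.≤-refl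
    lowest≤ (x ∷ y ∷ ys) (here refl) = ℕₚ.m⊓n≤m _ _
    lowest≤ (x ∷ y ∷ ys) (there v∈) = ℕₚ.≤-trans (ℕₚ.m⊓n≤n _ _) (lowest≤ (y ∷ ys) v∈)

    ≤highest : ∀ {v} xs → v ∈ xs → toℕ v ≤ highest xs
    ≤highest (x ∷ [])     (here refl) = ℕₚ.≤-refl
    ≤highest (x ∷ y ∷ ys) (here refl) = ℕₚ.m≤m⊔n _ _
    ≤highest (x ∷ y ∷ ys) (there v∈) = ℕₚ.≤-trans (≤highest (y ∷ ys) v∈) (ℕₚ.m≤n⊔m _ _)

    lowest-attained : ∀ x xs → ∃ λ v → v ∈ x ∷ xs × toℕ v ≡ lowest (x ∷ xs)
    lowest-attained x [] = x , here refl , refl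
    lowest-attained x (y ∷ ys) with ℕₚ.⊓-sel (toℕ x) (lowest (y ∷ ys))
    ... | inj₁ eq = x , here refl , sym eq
    ... | inj₂ eq = let (v , v∈ , v≡) = lowest-attained y ys in v , there v∈ , trans v≡ (sym eq)

    highest-attained : ∀ x xs → ∃ λ v → v ∈ x ∷ xs × toℕ v ≡ highest (x ∷ xs)
    highest-attained x [] = x , here refl , refl
    highest-attained x (y ∷ ys) with ℕₚ.⊔-sel (toℕ x) (highest (y ∷ ys))
    ... | inj₁ eq = x , here refl , sym eq
    ... | inj₂ eq = let (v , v∈ , v≡) = highest-attained y ys in v , there v∈ , trans v≡ (sym eq)

    Between : ℕ → ℕ → ℕ → Set
    Between i j k = (i ≤ k × k ≤ j) ⊎ (j ≤ k × k ≤ i)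

    between-step : ∀ {i i′ j k} → suc i ≡ i′ ⊎ suc i′ ≡ i → Between i j k → i ≢ k → Between i′ j k
    between-step (inj₁ refl) (inj₁ (i≤k , k≤j)) i≢k = inj₁ (ℕₚ.≤∧≢⇒< i≤k i≢k , k≤j)
    between-step (inj₂ refl) (inj₁ (i≤k , k≤j)) _   = inj₁ (ℕₚ.<⇒≤ i≤k , k≤j)
    between-step (inj₁ refl) (inj₂ (j≤k , k≤i)) _   = inj₂ (j≤k , ℕₚ.m≤n⇒m≤1+n k≤i)
    between-step (inj₂ refl) (inj₂ (j≤k , k≤i)) i≢k = inj₂ (j≤k , ℕₚ.≤-pred (ℕₚ.≤∧≢⇒< k≤i (i≢k ∘ sym)))

    pathGraph-intermediate : ∀ p ps → Linked (PathGraph m) (p ∷ ps) → ∀ {q} → q ∈ p ∷ ps →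
      ∀ k → Between (toℕ p) (toℕ q) k → ∃ λ v → v ∈ p ∷ ps × toℕ v ≡ k
    pathGraph-intermediate p ps _ (here refl) k (inj₁ (p≤k , k≤p)) = p , here refl , ℕₚ.≤-antisym p≤k k≤p
    pathGraph-intermediate p ps _ (here refl) k (inj₂ (p≤k , k≤p)) = p , here refl , ℕₚ.≤-antisym p≤k k≤p
    pathGraph-intermediate p (p′ ∷ ps) (edge ∷ linked) (there q∈) k between with toℕ p ℕₚ.≟ k
    ... | yes p≡k = p , here refl , p≡k
    ... | no p≢k =
      let (v , v∈ , v≡k) = pathGraph-intermediate p′ ps linked q∈ k (between-step edge between p≢k)
      in v , there v∈ , v≡k

  pathGraph-path-isSegment : ∀ ps → IsPath (PathGraph m) ps →
    ∃ λ a → ∃ λ b → IsSegment ps (a , b) × a ≤ b × b < m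
  pathGraph-path-isSegment (p ∷ ps) (_ , _ , linked , _) =
    lowest (p ∷ ps) , highest (p ∷ ps) , isSegment ,
    ℕₚ.≤-trans (lowest≤ (p ∷ ps) (here refl)) (≤highest (p ∷ ps) (here refl)) , highest<m
    where
    highest<m : highest (p ∷ ps) < m
    highest<m = let (v , _ , v≡) = highest-attained p ps in subst (_< m) v≡ (toℕ<n v)
    hit : ∀ {q v} → q ∈ p ∷ ps → Between (toℕ p) (toℕ q) (toℕ v) → v ∈ p ∷ ps
    hit q∈ between with pathGraph-intermediate p ps linked q∈ _ between
    ... | w , w∈ , w≡v = subst (_∈ p ∷ ps) (toℕ-injective w≡v) w∈
    isSegment : IsSegment (p ∷ ps) (lowest (p ∷ ps) , highest (p ∷ ps))
    isSegment v = (λ v∈ → lowest≤ (p ∷ ps) v∈ , ≤highest (p ∷ ps) v∈) , collect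
      where
      collect : lowest (p ∷ ps) ≤ toℕ v → toℕ v ≤ highest (p ∷ ps) → v ∈ p ∷ ps
      collect lo≤v v≤hi with toℕ p ℕₚ.≤? toℕ v
      ... | yes p≤v = let (h , h∈ , h≡) = highest-attained p ps in
                      hit h∈ (inj₁ (p≤v , subst (toℕ v ≤_) (sym h≡) v≤hi))
      ... | no p≰v  = let (l , l∈ , l≡) = lowest-attained p ps in
                      hit l∈ (inj₂ (subst (_≤ toℕ v) (sym l≡) lo≤v , ℕₚ.<⇒≤ (ℕₚ.≰⇒> p≰v)))

CI⇒IntervalRep : ∀ {A : Set} {R : A → A → Set} → CI R → IntervalRep R
CI⇒IntervalRep {A} (m , W , isPath , represents) = record
  { bound       = m
  ; left        = λ x → proj₁ (shape x)
  ; right       = λ x → proj₁ (proj₂ (shape x))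
  ; left≤right  = λ x → proj₁ (proj₂ (proj₂ (proj₂ (shape x))))
  ; right<bound = λ x → proj₂ (proj₂ (proj₂ (proj₂ (shape x))))
  ; sound       = λ {x} {y} xRy → let (_ , _ , x≈ , l≤r , r<m) = shape x ; (_ , _ , y≈ , _) = shape y in
                    ⊊ₗ⇒⊊ᵢ x≈ y≈ l≤r r<m (proj₁ (represents x y) xRy)
  ; complete    = λ {x} {y} x⊊y → let (_ , _ , x≈ , _) = shape x ; (_ , _ , y≈ , l≤r , r<m) = shape y in
                    proj₂ (represents x y) (⊊ᵢ⇒⊊ₗ x≈ y≈ l≤r r<m x⊊y)
  }
  where
  shape : ∀ x → ∃ λ a → ∃ λ b → IsSegment (W x) (a , b) × a ≤ b × b < m
  shape x = pathGraph-path-isSegment (W x) (isPath x)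

IntervalRep⇒CI : ∀ {A : Set} {R : A → A → Set} → IntervalRep R → CI R
IntervalRep⇒CI {A} I = bound , W , (λ x → segment-isPath (left x) (width x) (fits x)) , λ x y →
  (λ xRy → ⊊ᵢ⇒⊊ₗ (W-isSegment x) (W-isSegment y) (left≤right y) (right<bound y) (sound xRy)) ,
  (λ x⊊y → complete (⊊ₗ⇒⊊ᵢ (W-isSegment x) (W-isSegment y) (left≤right x) (right<bound x) x⊊y))
  where
  open IntervalRep I
  width : A → ℕ
  width x = right x ∸ left x
  left+width≡right : ∀ x → left x + width x ≡ right x
  left+width≡right x = ℕₚ.m+[n∸m]≡n (left≤right x)
  fits : ∀ x → left x + width x < bound
  fits x = subst (_< bound) (sym (left+width≡right x)) (right<bound x)
  W : A → List (Fin bound)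
  W x = segment (left x) (width x) (fits x)
  W-isSegment : ∀ x → IsSegment (W x) (left x , right x)
  W-isSegment x = subst (λ r → IsSegment (W x) (left x , r)) (left+width≡right x)
                        (segment-isSegment (left x) (width x) (fits x))

CI-dual : ∀ {A : Set} {R : A → A → Set} → CI R → CI (flip' R)
CI-dual = IntervalRep⇒CI ∘ IntervalRep-dual ∘ CI⇒IntervalRep

module _ {m m′ : ℕ} {E : Fin m → Fin m → Set} {E′ : Fin m′ → Fin m′ → Set}
         (f : Fin m → Fin m′) (S : Fin m → Set)
         (f-injective : ∀ {v w} → S v → S w → f v ≡ f w → v ≡ w)
         (f-edge : ∀ {v w} → S v → S w → E v w → E′ (f v) (f w)) where

  private
    Within : List (Fin m) → Set
    Within ws = ∀ w → w ∈ ws → S w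

    map-linked : ∀ ws → Within ws → Linked E ws → Linked E′ (map f ws)
    map-linked []           _  _             = []
    map-linked (_ ∷ [])     _  _             = [-]
    map-linked (v ∷ w ∷ ws) ws⊆S (e ∷ linked) =
      f-edge (ws⊆S v (here refl)) (ws⊆S w (there (here refl))) e ∷ map-linked (w ∷ ws) (λ u → ws⊆S u ∘ there) linked

    map-unique : ∀ ws → Within ws → Unique ws → Unique (map f ws)
    map-unique []       _    _                = []
    map-unique (v ∷ ws) ws⊆S (v∉ws ∷ unique) =
      fresh ws (λ u → ws⊆S u ∘ there) v∉ws ∷ map-unique ws (λ u → ws⊆S u ∘ there) unique
      where
      fresh : ∀ us → Within us → All (v ≢_) us → All (f v ≢_) (map f us)
      fresh []       _    _             = []
      fresh (u ∷ us) us⊆S (v≢u ∷ v∉us) =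
        (v≢u ∘ f-injective (ws⊆S v (here refl)) (us⊆S u (here refl))) ∷ fresh us (λ w → us⊆S w ∘ there) v∉us

    map-⊊ₗ : ∀ xs ys → Within xs → Within ys → xs ⊊ₗ ys → map f xs ⊊ₗ map f ys
    map-⊊ₗ xs ys xs⊆S ys⊆S (xs⊆ys , w , w∈ys , w∉xs) = image⊆ , f w , ∈-map⁺ f w∈ys , fw∉
      where
      image⊆ : ∀ u → u ∈ map f xs → u ∈ map f ys
      image⊆ u u∈ with ∈-map⁻ f u∈
      ... | v , v∈xs , refl = ∈-map⁺ f (xs⊆ys v v∈xs)
      fw∉ : ¬ f w ∈ map f xs
      fw∉ fw∈ with ∈-map⁻ f fw∈
      ... | v , v∈xs , fw≡fv = w∉xs (subst (_∈ xs) (sym (f-injective (ys⊆S w w∈ys) (xs⊆S v v∈xs) fw≡fv)) v∈xs)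

    ⊊ₗ-map : ∀ xs ys → Within xs → Within ys → map f xs ⊊ₗ map f ys → xs ⊊ₗ ys
    ⊊ₗ-map xs ys xs⊆S ys⊆S (image⊆ , u , u∈ys , u∉xs) = xs⊆ys , new
      where
      xs⊆ys : ∀ v → v ∈ xs → v ∈ ys
      xs⊆ys v v∈xs with ∈-map⁻ f (image⊆ (f v) (∈-map⁺ f v∈xs))
      ... | w , w∈ys , fv≡fw = subst (_∈ ys) (sym (f-injective (xs⊆S v v∈xs) (ys⊆S w w∈ys) fv≡fw)) w∈ys
      new : ∃ λ w → w ∈ ys × ¬ w ∈ xs
      new with ∈-map⁻ f u∈ys
      ... | w , w∈ys , refl = w , w∈ys , u∉xs ∘ ∈-map⁺ f

  PathRep-map : ∀ {A : Set} {R : A → A → Set} → (rep : PathRep R m E) →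
    (∀ x w → w ∈ proj₁ rep x → S w) → PathRep R m′ E′
  PathRep-map (W , isPath , represents) W⊆S = map f ∘ W , isPath′ , λ x y →
    map-⊊ₗ (W x) (W y) (W⊆S x) (W⊆S y) ∘ proj₁ (represents x y) ,
    proj₂ (represents x y) ∘ ⊊ₗ-map (W x) (W y) (W⊆S x) (W⊆S y)
    where
    isPath′ : ∀ x → IsPath E′ (map f (W x))
    isPath′ x with isPath x
    ... | u , v , linked , unique , starts , ends =
      f u , f v , map-linked (W x) (W⊆S x) linked , map-unique (W x) (W⊆S x) unique ,
      trans (head-map {f = f} (W x)) (cong (Maybe.map f) starts) , trans (last-map f (W x)) (cong (Maybe.map f) ends)

module _ {m : ℕ} where

  position : Fin m → List (Fin m) → ℕ
  position v [] = 0
  position v (p ∷ ps) with v ≟ᶠ p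
  ... | yes _ = 0
  ... | no _  = suc (position v ps)

  position≤length : ∀ v ps → position v ps ≤ length ps
  position≤length v [] = z≤n
  position≤length v (p ∷ ps) with v ≟ᶠ p
  ... | yes _ = z≤n
  ... | no _  = s≤s (position≤length v ps)

  position-injective : ∀ {v w} ps → v ∈ ps → w ∈ ps → position v ps ≡ position w ps → v ≡ w
  position-injective {v} {w} (p ∷ ps) v∈ w∈ eq with v ≟ᶠ p | w ≟ᶠ p
  ... | yes v≡p | yes w≡p = trans v≡p (sym w≡p)
  position-injective (p ∷ ps) (here v≡p)  _           _  | no v≢p | no _    = ⊥-elim (v≢p v≡p)
  position-injective (p ∷ ps) (there _)   (here w≡p)  _  | no _   | no w≢p  = ⊥-elim (w≢p w≡p)
  position-injective (p ∷ ps) (there v∈)  (there w∈)  eq | no _   | no _    =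
    position-injective ps v∈ w∈ (ℕₚ.suc-injective eq)

  module _ {E : Fin m → Fin m → Set} where

    path-from-head : ∀ p ps → Linked E (p ∷ ps) → Unique (p ∷ ps) → ∀ {b} → b ∈ p ∷ ps →
      ∃ λ s → IsPathFromTo E p b s × (∀ w → w ∈ s → w ∈ p ∷ ps) × length s ≡ suc (position b (p ∷ ps))
    path-from-head p ps _ _ {b} b∈ with b ≟ᶠ p
    ... | yes refl = p ∷ [] , ([-] , [] ∷ [] , refl , refl) , (λ { w (here w≡p) → here w≡p }) , refl
    path-from-head p ps _ _ (here b≡p) | no b≢p = ⊥-elim (b≢p b≡p)
    path-from-head p (p′ ∷ ps) (e ∷ linked) (p∉ps ∷ unique) (there b∈) | no _
      with path-from-head p′ ps linked unique b∈
    ... | x ∷ s , (linked′ , unique′ , refl , ends) , s⊆ps , length≡ =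
      p ∷ x ∷ s , (e ∷ linked′ , p∉s ∷ unique′ , refl , ends) , extend , cong suc length≡
      where
      p∉s : All (p ≢_) (x ∷ s)
      p∉s = All.tabulate (λ w∈ → All.lookup p∉ps (s⊆ps _ w∈))
      extend : ∀ w → w ∈ p ∷ x ∷ s → w ∈ p ∷ p′ ∷ ps
      extend w (here w≡p) = here w≡p
      extend w (there w∈) = there (s⊆ps w w∈)

    path-between : ∀ ps → Linked E ps → Unique ps → ∀ {a b} → a ∈ ps → b ∈ ps →
      position a ps ≤ position b ps →
      ∃ λ s → IsPathFromTo E a b s × suc (position b ps) ≡ position a ps + length s
    path-between (p ∷ ps) linked unique {a} {b} a∈ b∈ a≤b with a ≟ᶠ p
    ... | yes refl = let (s , s-path , _ , length≡) = path-from-head p ps linked unique b∈ in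
                     s , s-path , sym length≡
    ... | no a≢p with b ≟ᶠ p
    ...   | yes refl = ⊥-elim (ℕₚ.≤⇒≯ a≤b (s≤s z≤n))
    path-between (p ∷ ps) linked unique (here a≡p) _ _ | no a≢p | no _ = ⊥-elim (a≢p a≡p)
    path-between (p ∷ ps) linked unique (there _) (here b≡p) _ | no _ | no b≢p = ⊥-elim (b≢p b≡p)
    path-between (p ∷ ps) linked (_ ∷ unique) (there a∈) (there b∈) a≤b | no _ | no _ =
      let (s , s-path , length≡) = path-between ps (Linked.tail linked) unique a∈ b∈ (ℕₚ.≤-pred a≤b) in
      s , s-path , cong suc length≡

    private
      -- The unique path from a to b in the tree is the edge ab, so the stretch of ps between them has two vertices.
      tree-path-edge-forward : IsTree E → ∀ ps → Linked E ps → Unique ps → ∀ {a b} → a ∈ ps → b ∈ ps → E a b →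
        position a ps ≤ position b ps → suc (position a ps) ≡ position b ps
      tree-path-edge-forward tree ps linked unique {a} {b} a∈ b∈ e a≤b with path-between ps linked unique a∈ b∈ a≤b
      ... | s , s-path , length≡ with IsTree.unique tree a b s (a ∷ b ∷ []) s-path edge-path
        where
        edge-path : IsPathFromTo E a b (a ∷ b ∷ [])
        edge-path = e ∷ [-] , ((λ a≡b → IsTree.irrefl tree a (subst (E a) (sym a≡b) e)) ∷ []) ∷ [] ∷ [] , refl , refl
      ... | refl = ℕₚ.suc-injective (sym (trans length≡ (ℕₚ.+-comm (position a ps) 2)))

    tree-path-edge : IsTree E → ∀ ps → Linked E ps → Unique ps → ∀ {a b} → a ∈ ps → b ∈ ps → E a b →
      suc (position a ps) ≡ position b ps ⊎ suc (position b ps) ≡ position a ps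
    tree-path-edge tree ps linked unique a∈ b∈ e with ℕₚ.≤-total (position _ ps) (position _ ps)
    ... | inj₁ a≤b = inj₁ (tree-path-edge-forward tree ps linked unique a∈ b∈ e a≤b)
    ... | inj₂ b≤a = inj₂ (tree-path-edge-forward tree ps linked unique b∈ a∈ (IsTree.sym tree e) b≤a)

-- Numbering the vertices of the tree path W y by their position turns it into a path graph,
-- and the paths of the elements below y all lie inside W y.
CPT⇒CI-below : ∀ {A : Set} {R : A → A → Set} {Q : A → Set} → CPT R → (y : A) → (∀ z → Q z → R z y) →
  CI (λ (a b : Σ A Q) → R (proj₁ a) (proj₁ b))
CPT⇒CI-below (m , E , tree , rep@(W , isPath , represents)) y below with isPath y
... | _ , _ , linked , unique , _ =
  suc (length (W y)) ,
  PathRep-map index (_∈ W y) index-injective index-edge (PathRep-restrict proj₁ rep)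
    (λ (z , Qz) w w∈ → proj₁ (proj₁ (represents z y) (below z Qz)) w w∈)
  where
  index : Fin m → Fin (suc (length (W y)))
  index v = fromℕ< (s≤s (position≤length v (W y)))
  toℕ-index : ∀ v → toℕ (index v) ≡ position v (W y)
  toℕ-index v = toℕ-fromℕ< (s≤s (position≤length v (W y)))
  index-injective : ∀ {v w} → v ∈ W y → w ∈ W y → index v ≡ index w → v ≡ w
  index-injective v∈ w∈ eq =
    position-injective (W y) v∈ w∈ (trans (sym (toℕ-index _)) (trans (cong toℕ eq) (toℕ-index _)))
  index-edge : ∀ {v w} → v ∈ W y → w ∈ W y → E v w → PathGraph (suc (length (W y))) (index v) (index w)
  index-edge {v} {w} v∈ w∈ e rewrite toℕ-index v | toℕ-index w = tree-path-edge tree (W y) linked unique v∈ w∈ e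

module _ {n : ℕ} {Q : Fin n → Set} (Q? : ∀ i → Dec (Q i)) where

  subsetOf : Subset n
  subsetOf = tabulate (λ i → does (Q? i))

  ∈-subsetOf⁺ : ∀ {i} → Q i → i ∈ₛ subsetOf
  ∈-subsetOf⁺ {i} Qi = lookup⇒[]= i _ (trans (lookup∘tabulate _ i) (dec-true (Q? i) Qi))

  ∈-subsetOf⁻ : ∀ {i} → i ∈ₛ subsetOf → Q i
  ∈-subsetOf⁻ {i} i∈ with Q? i | trans (sym (lookup∘tabulate _ i)) ([]=⇒lookup i∈)
  ... | yes Qi | _ = Qi
  ... | no _   | ()

module Modules (P : FinPoset) (_≺?_ : Decidable (FinPoset._≺_ P)) where
  open FinPoset P renaming (trans to ≺-trans)

  X : Set
  X = Fin size

  ≺-asym : ∀ {x y} → x ≺ y → ¬ y ≺ x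
  ≺-asym x≺y y≺x = irrefl _ (≺-trans x≺y y≺x)

  Comparable-sym : ∀ {x y} → Comparable P x y → Comparable P y x
  Comparable-sym (inj₁ x≺y) = inj₂ x≺y
  Comparable-sym (inj₂ y≺x) = inj₁ y≺x

  comparable? : Decidable (Comparable P)
  comparable? x y = x ≺? y ⊎-dec y ≺? x

  module-comparable : ∀ {M t z} → IsModule P M → t ∉ₛ M → z ∈ₛ M → Comparable P t z →
    ∀ w → w ∈ₛ M → Comparable P t w
  module-comparable (_ , uniform) t∉M z∈M t~z with uniform _ t∉M
  ... | inj₁ t~M  = t~M
  ... | inj₂ t≁M = ⊥-elim (t≁M _ z∈M t~z)

  -- The elements of M below y, together with the outside elements lying between two elements of M,
  -- form a module that meets M but is neither contained in M nor contains it.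
  private
    module Straddling (M : Subset size) (strong : IsStrongModule P M) {y a b : X}
                      (y∉M : y ∉ₛ M) (a∈M : a ∈ₛ M) (b∈M : b ∈ₛ M) (a≺y : a ≺ y) (y≺b : y ≺ b) where

      Lower Inner : X → Set
      Lower t = t ∈ₛ M × t ≺ y
      Inner t = t ∉ₛ M × (∃ λ z → z ∈ₛ M × z ≺ t) × (∃ λ z → z ∈ₛ M × t ≺ z)

      InK? : ∀ t → Dec (Lower t ⊎ Inner t)
      InK? t = ((t ∈ₛ? M) ×-dec t ≺? y) ⊎-dec
        (¬? (t ∈ₛ? M) ×-dec any? (λ z → (z ∈ₛ? M) ×-dec z ≺? t) ×-dec any? (λ z → (z ∈ₛ? M) ×-dec t ≺? z))

      K : Subset size
      K = subsetOf InK?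

      M-module : IsModule P M
      M-module = proj₁ strong

      y~M : ∀ w → w ∈ₛ M → Comparable P y w
      y~M = module-comparable M-module y∉M a∈M (inj₂ a≺y)

      K-module : IsModule P K
      K-module = (a , ∈-subsetOf⁺ InK? (inj₁ (a∈M , a≺y))) , outside
        where
        outside : ∀ v → v ∉ₛ K → (∀ t → t ∈ₛ K → Comparable P v t) ⊎ (∀ t → t ∈ₛ K → ¬ Comparable P v t)
        outside v v∉K with v ∈ₛ? M
        ... | yes v∈M = inj₁ λ t t∈K → above-K (∈-subsetOf⁻ InK? t∈K)
          where
          y≺v : y ≺ v
          y≺v with y~M v v∈M
          ... | inj₁ y≺v = y≺v
          ... | inj₂ v≺y = ⊥-elim (v∉K (∈-subsetOf⁺ InK? (inj₁ (v∈M , v≺y))))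
          above-K : ∀ {t} → Lower t ⊎ Inner t → Comparable P v t
          above-K (inj₁ (_ , t≺y))                 = inj₂ (≺-trans t≺y y≺v)
          above-K (inj₂ (t∉M , (z , z∈M , z≺t) , _)) =
            Comparable-sym (module-comparable M-module t∉M z∈M (inj₂ z≺t) v v∈M)
        ... | no v∉M with proj₂ M-module v v∉M
        ...   | inj₁ v~M = inj₁ λ t t∈K → related-K (∈-subsetOf⁻ InK? t∈K)
          where
          not-inner : ¬ Inner v
          not-inner = v∉K ∘ ∈-subsetOf⁺ InK? ∘ inj₂
          related-K : ∀ {t} → Lower t ⊎ Inner t → Comparable P v t
          related-K (inj₁ (t∈M , _)) = v~M _ t∈M
          related-K (inj₂ (_ , (z , z∈M , z≺t) , (z′ , z′∈M , t≺z′))) with v~M a a∈M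
          ... | inj₁ v≺a with v~M z z∈M
          ...   | inj₁ v≺z = inj₁ (≺-trans v≺z z≺t)
          ...   | inj₂ z≺v = ⊥-elim (not-inner (v∉M , (z , z∈M , z≺v) , (a , a∈M , v≺a)))
          related-K (inj₂ (_ , (z , z∈M , z≺t) , (z′ , z′∈M , t≺z′))) | inj₂ a≺v with v~M z′ z′∈M
          ...   | inj₂ z′≺v = inj₂ (≺-trans t≺z′ z′≺v)
          ...   | inj₁ v≺z′ = ⊥-elim (not-inner (v∉M , (a , a∈M , a≺v) , (z′ , z′∈M , v≺z′)))
        ...   | inj₂ v≁M = inj₂ λ t t∈K → unrelated-K (∈-subsetOf⁻ InK? t∈K)
          where
          unrelated-K : ∀ {t} → Lower t ⊎ Inner t → ¬ Comparable P v t
          unrelated-K (inj₁ (t∈M , _)) = v≁M _ t∈M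
          unrelated-K (inj₂ (_ , _ , (z , z∈M , t≺z))) (inj₁ v≺t) = v≁M z z∈M (inj₁ (≺-trans v≺t t≺z))
          unrelated-K (inj₂ (_ , (z , z∈M , z≺t) , _)) (inj₂ t≺v) = v≁M z z∈M (inj₂ (≺-trans z≺t t≺v))

      impossible : ⊥
      impossible with proj₂ strong K K-module
      ... | inj₁ disjoint = disjoint a a∈M (∈-subsetOf⁺ InK? (inj₁ (a∈M , a≺y)))
      ... | inj₂ (inj₁ M⊆K) with ∈-subsetOf⁻ InK? (M⊆K b∈M)
      ...   | inj₁ (_ , b≺y) = ≺-asym y≺b b≺y
      ...   | inj₂ (b∉M , _) = b∉M b∈M
      impossible | inj₂ (inj₂ K⊆M) = y∉M (K⊆M (∈-subsetOf⁺ InK? (inj₂ (y∉M , (a , a∈M , a≺y) , (b , b∈M , y≺b)))))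

  strong-module-below : ∀ {M} → IsStrongModule P M → ∀ {y a b} → y ∉ₛ M → a ∈ₛ M → b ∈ₛ M → a ≺ y → b ≺ y
  strong-module-below {M} strong y∉M a∈M b∈M a≺y with module-comparable (proj₁ strong) y∉M a∈M (inj₂ a≺y) _ b∈M
  ... | inj₂ b≺y = b≺y
  ... | inj₁ y≺b = ⊥-elim (Straddling.impossible M strong y∉M a∈M b∈M a≺y y≺b)

  strong-module-above : ∀ {M} → IsStrongModule P M → ∀ {y a b} → y ∉ₛ M → a ∈ₛ M → b ∈ₛ M → y ≺ a → y ≺ b
  strong-module-above {M} strong y∉M a∈M b∈M y≺a with module-comparable (proj₁ strong) y∉M a∈M (inj₁ y≺a) _ b∈M
  ... | inj₁ y≺b = y≺b
  ... | inj₂ b≺y = ⊥-elim (Straddling.impossible M strong y∉M b∈M a∈M b≺y y≺a)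

  connected⇒module-neighbour : ComparabilityConnected P → ∀ {M} → IsModule P M → M ≢ ⊤ →
    ∃ λ y → y ∉ₛ M × (∀ z → z ∈ₛ M → Comparable P y z)
  connected⇒module-neighbour connected {M} M-module@((a , a∈M) , uniform) M≢⊤ with any? (λ w → ¬? (w ∈ₛ? M))
  ... | no M-full = ⊥-elim (M≢⊤ (⊆-antisym (λ _ → ∈⊤) (λ {x} _ → decidable-stable (x ∈ₛ? M) (M-full ∘ (x ,_)))))
  ... | yes (w , w∉M) = leave a∈M (connected a w) w∉M
    where
    leave : ∀ {a w} → a ∈ₛ M → Star (Comparable P) a w → w ∉ₛ M → ∃ λ y → y ∉ₛ M × (∀ z → z ∈ₛ M → Comparable P y z)
    leave a∈M ε w∉M = ⊥-elim (w∉M a∈M)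
    leave a∈M (_◅_ {j = a′} a~a′ walk) w∉M with a′ ∈ₛ? M
    ... | yes a′∈M = leave a′∈M walk w∉M
    ... | no a′∉M  = a′ , a′∉M , module-comparable M-module a′∉M a∈M (Comparable-sym a~a′)

  private
    all-in? : ∀ (M : Subset size) {Q : X → Set} → (∀ z → Dec (Q z)) → Dec (∀ z → z ∈ₛ M → Q z)
    all-in? M Q? = all? (λ z → z ∈ₛ? M →-dec Q? z)

    Overlapping : Subset size → Subset size → Set
    Overlapping M M′ = (∀ z → z ∈ₛ M → z ∉ₛ M′) ⊎ (M ⊆ M′ ⊎ M′ ⊆ M)

    overlapping? : ∀ M M′ → Dec (Overlapping M M′)
    overlapping? M M′ = all-in? M (λ z → ¬? (z ∈ₛ? M′)) ⊎-dec (M ⊆ₛ? M′ ⊎-dec M′ ⊆ₛ? M)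

  isModule? : ∀ M → Dec (IsModule P M)
  isModule? M = nonempty? M ×-dec all? (λ y → ¬? (y ∈ₛ? M) →-dec
    (all-in? M (comparable? y) ⊎-dec all-in? M (λ z → ¬? (comparable? y z))))

  isStrongModule? : ∀ M → Dec (IsStrongModule P M)
  isStrongModule? M with isModule? M | anySubset? (λ M′ → isModule? M′ ×-dec ¬? (overlapping? M M′))
  ... | no ¬module | _ = no (¬module ∘ proj₁)
  ... | yes _ | yes (M′ , M′-module , ¬overlap) = no (λ strong → ¬overlap (proj₂ strong M′ M′-module))
  ... | yes M-module | no none =
    yes (M-module , λ M′ M′-module →
           decidable-stable (overlapping? M M′) (λ ¬overlap → none (M′ , M′-module , ¬overlap)))

  ⁅⁆-strong : ∀ x → IsStrongModule P ⁅ x ⁆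
  ⁅⁆-strong x = ((x , x∈⁅x⁆ x) , uniform) , nested
    where
    uniform : ∀ y → y ∉ₛ ⁅ x ⁆ → (∀ z → z ∈ₛ ⁅ x ⁆ → Comparable P y z) ⊎ (∀ z → z ∈ₛ ⁅ x ⁆ → ¬ Comparable P y z)
    uniform y _ with comparable? y x
    ... | yes y~x = inj₁ λ z z∈ → subst (Comparable P y) (sym (x∈⁅y⁆⇒x≡y x z∈)) y~x
    ... | no y≁x  = inj₂ λ z z∈ → subst (¬_ ∘ Comparable P y) (sym (x∈⁅y⁆⇒x≡y x z∈)) y≁x
    nested : ∀ M′ → IsModule P M′ → Overlapping ⁅ x ⁆ M′
    nested M′ _ with x ∈ₛ? M′
    ... | yes x∈M′ = inj₂ (inj₁ λ z∈ → subst (_∈ₛ M′) (sym (x∈⁅y⁆⇒x≡y x z∈)) x∈M′)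
    ... | no x∉M′  = inj₁ λ z z∈ → subst (_∉ₛ M′) (sym (x∈⁅y⁆⇒x≡y x z∈)) x∉M′

  _≟⊤ : ∀ (M : Subset size) → Dec (M ≡ ⊤)
  M ≟⊤ = ≡-dec Boolₚ._≟_ M ⊤

  strong⇒maximal : ∀ {S} → IsStrongModule P S → S ≢ ⊤ → ∃ λ M → IsMaximalStrongModule P M × S ⊆ M
  strong⇒maximal = grow (⊃-wellFounded _)
    where
    grow : ∀ {S} → Acc _⊃_ S → IsStrongModule P S → S ≢ ⊤ → ∃ λ M → IsMaximalStrongModule P M × S ⊆ M
    grow {S} (acc larger) S-strong S≢⊤ with anySubset? (λ S′ → isStrongModule? S′ ×-dec S ⊂? S′ ×-dec ¬? (S′ ≟⊤))
    ... | yes (S′ , S′-strong , S⊂S′ , S′≢⊤) =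
      let (M , M-maximal , S′⊆M) = grow (larger S⊂S′) S′-strong S′≢⊤ in M , M-maximal , S′⊆M ∘ proj₁ S⊂S′
    ... | no none = S , (S-strong , S≢⊤ , λ M′ M′-strong S⊂M′ →
                           decidable-stable (M′ ≟⊤) (λ M′≢⊤ → none (M′ , M′-strong , S⊂M′ , M′≢⊤))) , id

  private
    maximal-⊆ : ∀ {M M′} → IsMaximalStrongModule P M → IsStrongModule P M′ → M′ ≢ ⊤ → M ⊆ M′ → M ≡ M′
    maximal-⊆ {M} {M′} (_ , _ , maximal) M′-strong M′≢⊤ M⊆M′ with any? (λ z → (z ∈ₛ? M′) ×-dec ¬? (z ∈ₛ? M))
    ... | yes (z , z∈M′ , z∉M) = ⊥-elim (M′≢⊤ (maximal M′ M′-strong (M⊆M′ , z , z∈M′ , z∉M)))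
    ... | no M′⊆M = ⊆-antisym M⊆M′ λ {z} z∈M′ → decidable-stable (z ∈ₛ? M) (λ z∉M → M′⊆M (z , z∈M′ , z∉M))

  maximal-unique : ∀ {M M′ x} → IsMaximalStrongModule P M → IsMaximalStrongModule P M′ →
    x ∈ₛ M → x ∈ₛ M′ → M ≡ M′
  maximal-unique M-max@(M-strong , _) M′-max@(M′-strong , M′≢⊤ , _) x∈M x∈M′ with proj₂ M-strong _ (proj₁ M′-strong)
  ... | inj₁ disjoint      = ⊥-elim (disjoint _ x∈M x∈M′)
  ... | inj₂ (inj₁ M⊆M′) = maximal-⊆ M-max M′-strong M′≢⊤ M⊆M′
  ... | inj₂ (inj₂ M′⊆M) = sym (maximal-⊆ M′-max M-strong (proj₁ (proj₂ M-max)) M′⊆M)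

  strong-modules-uniform : ∀ {M M′} → IsStrongModule P M → IsStrongModule P M′ → (∀ z → z ∈ₛ M → z ∉ₛ M′) →
    ∀ {x s y t} → x ∈ₛ M → s ∈ₛ M → y ∈ₛ M′ → t ∈ₛ M′ → x ≺ y → s ≺ t
  strong-modules-uniform M-strong M′-strong disjoint x∈M s∈M y∈M′ t∈M′ x≺y =
    strong-module-above M′-strong (disjoint _ s∈M) y∈M′ t∈M′
      (strong-module-below M-strong (λ y∈M → disjoint _ y∈M y∈M′) x∈M s∈M x≺y)

maxOver : ∀ {n} → (Fin n → ℕ) → ℕ
maxOver {zero}  f = 0
maxOver {suc n} f = f zero ⊔ maxOver (f ∘ suc)

≤maxOver : ∀ {n} (f : Fin n → ℕ) i → f i ≤ maxOver f
≤maxOver f zero    = ℕₚ.m≤m⊔n _ _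
≤maxOver f (suc i) = ℕₚ.≤-trans (≤maxOver (f ∘ suc) i) (ℕₚ.m≤n⊔m _ _)

lex-< : ∀ {a a′ b b′ B} → b < B → a < a′ → a * B + b < a′ * B + b′
lex-< {a} {a′} {b} {b′} {B} b<B a<a′ = begin-strict
  a * B + b   <⟨ ℕₚ.+-monoʳ-< (a * B) b<B ⟩
  a * B + B   ≡⟨ ℕₚ.+-comm (a * B) B ⟩
  suc a * B   ≤⟨ ℕₚ.*-monoˡ-≤ B a<a′ ⟩
  a′ * B      ≤⟨ ℕₚ.m≤m+n (a′ * B) b′ ⟩
  a′ * B + b′ ∎
  where open ℕₚ.≤-Reasoning

lex-≤⇒≤ : ∀ {a a′ b b′ B} → b′ < B → a * B + b ≤ a′ * B + b′ → a ≤ a′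
lex-≤⇒≤ {a} {a′} b′<B ab≤a′b′ with a ≤? a′
... | yes a≤a′ = a≤a′
... | no a≰a′  = ⊥-elim (ℕₚ.<⇒≱ (lex-< b′<B (ℕₚ.≰⇒> a≰a′)) ab≤a′b′)

+-⊊ᵢ⇔ : ∀ p q {a b c d} → (p + a , q + b) ⊊ᵢ (p + c , q + d) ⇔ (a , b) ⊊ᵢ (c , d)
+-⊊ᵢ⇔ p q = mk⇔
  (λ (c≤a , b≤d , strict) → ℕₚ.+-cancelˡ-≤ p _ _ c≤a , ℕₚ.+-cancelˡ-≤ q _ _ b≤d ,
                             [ inj₁ ∘ ℕₚ.+-cancelˡ-< p _ _ , inj₂ ∘ ℕₚ.+-cancelˡ-< q _ _ ] strict)
  (λ (c≤a , b≤d , strict) → ℕₚ.+-monoʳ-≤ p c≤a , ℕₚ.+-monoʳ-≤ q b≤d ,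
                             [ inj₁ ∘ ℕₚ.+-monoʳ-< p , inj₂ ∘ ℕₚ.+-monoʳ-< q ] strict)

module _ {n : ℕ} {R : Fin n → Fin n → Set} (ρ : Fin n → Fin n) {S : Fin n → Fin n → Set}
         (outer : IntervalRep S)
         (inner : ∀ s → IntervalRep (λ (x y : Σ (Fin n) λ x → ρ x ≡ s) → R (proj₁ x) (proj₁ y)))
         (across : ∀ {x y} → ρ x ≢ ρ y → R x y ⇔ S (ρ x) (ρ y)) where

  private
    open IntervalRep outer using (left≤right; right<bound) renaming (bound to N; left to l; right to r)
    module Inner s = IntervalRep (inner s)

    Block : Fin n → Set
    Block s = Σ (Fin n) λ x → ρ x ≡ s

    B : ℕ
    B = maxOver Inner.bound

    inner-right<B : ∀ s (x : Block s) → Inner.right s x < B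
    inner-right<B s x = ℕₚ.<-≤-trans (Inner.right<bound s x) (≤maxOver Inner.bound s)

    inner-left<B : ∀ s (x : Block s) → Inner.left s x < B
    inner-left<B s x = ℕₚ.≤-<-trans (Inner.left≤right s x) (inner-right<B s x)

    -- Comparing left ends by (l , N ∸ r , s) and right ends by (r , N ∸ l , s) nests the intervals of two
    -- blocks exactly when their outer intervals are nested, and makes them cross when those coincide.
    key : ℕ → ℕ → Fin n → ℕ
    key a c s = (a * suc N + (N ∸ c)) * n + toℕ s

    leftKey rightKey : Fin n → ℕ
    leftKey s  = key (l s) (r s) s
    rightKey s = key (r s) (l s) s

    leftIn rightIn : ∀ s → Block s → ℕ
    leftIn s x  = leftKey s * B + Inner.left s x
    rightIn s x = rightKey s * B + Inner.right s x

    key-< : ∀ {a a′ c c′} s t → a′ ≤ a → a′ < a ⊎ c < c′ → c′ ≤ N → key a′ c′ t < key a c s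
    key-< {a} {a′} {c} {c′} s t a′≤a a′<a⊎c<c′ c′≤N with ℕₚ.m≤n⇒m<n∨m≡n a′≤a | a′<a⊎c<c′
    ... | inj₁ a′<a | _         = lex-< (toℕ<n t) (lex-< (s≤s (ℕₚ.m∸n≤m N c′)) a′<a)
    ... | inj₂ refl | inj₁ a<a  = ⊥-elim (ℕₚ.<-irrefl refl a<a)
    ... | inj₂ refl | inj₂ c<c′ = lex-< (toℕ<n t) (ℕₚ.+-monoʳ-< (a * suc N) (ℕₚ.∸-monoʳ-< c<c′ c′≤N))

    key-≤⇒≤ : ∀ {a a′ c c′} s t → key a′ c′ t ≤ key a c s → a′ ≤ a
    key-≤⇒≤ {c = c} s t k≤k = lex-≤⇒≤ (s≤s (ℕₚ.m∸n≤m N c)) (lex-≤⇒≤ (toℕ<n s) k≤k)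

    key-≤⇒toℕ-≤ : ∀ {a a′ c c′} s t → a′ ≡ a → c′ ≡ c → key a′ c′ t ≤ key a c s → toℕ t ≤ toℕ s
    key-≤⇒toℕ-≤ {a} {c = c} s t refl refl = ℕₚ.+-cancelˡ-≤ ((a * suc N + (N ∸ c)) * n) _ _

    different-blocks : ∀ {s t} (x : Block s) (y : Block t) → s ≢ t →
      (l s , r s) ⊊ᵢ (l t , r t) ⇔ (leftIn s x , rightIn s x) ⊊ᵢ (leftIn t y , rightIn t y)
    different-blocks {s} {t} x y s≢t = mk⇔ to from
      where
      r≤N : ∀ s → r s ≤ N
      r≤N s = ℕₚ.<⇒≤ (right<bound s)
      l≤N : ∀ s → l s ≤ N
      l≤N s = ℕₚ.≤-trans (left≤right s) (r≤N s)
      swap : ∀ {i j k o} → i < j ⊎ k < o → k < o ⊎ i < j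
      swap = [ inj₂ , inj₁ ]
      to : (l s , r s) ⊊ᵢ (l t , r t) → (leftIn s x , rightIn s x) ⊊ᵢ (leftIn t y , rightIn t y)
      to (lt≤ls , rs≤rt , strict) = ℕₚ.<⇒≤ left< , ℕₚ.<⇒≤ right< , inj₁ left<
        where
        left< : leftIn t y < leftIn s x
        left< = lex-< (inner-left<B t y) (key-< s t lt≤ls strict (r≤N t))
        right< : rightIn s x < rightIn t y
        right< = lex-< (inner-right<B s x) (key-< t s rs≤rt (swap strict) (l≤N s))
      from : (leftIn s x , rightIn s x) ⊊ᵢ (leftIn t y , rightIn t y) → (l s , r s) ⊊ᵢ (l t , r t)
      from (left≤ , right≤ , _) = lt≤ls , rs≤rt , strict
        where
        leftKey≤ : leftKey t ≤ leftKey s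
        leftKey≤ = lex-≤⇒≤ (inner-left<B s x) left≤
        rightKey≤ : rightKey s ≤ rightKey t
        rightKey≤ = lex-≤⇒≤ (inner-right<B t y) right≤
        lt≤ls : l t ≤ l s
        lt≤ls = key-≤⇒≤ {c = r s} {c′ = r t} s t leftKey≤
        rs≤rt : r s ≤ r t
        rs≤rt = key-≤⇒≤ {c = l t} {c′ = l s} t s rightKey≤
        -- With equal outer intervals the last digit, toℕ s, decides both keys.
        strict : l t < l s ⊎ r s < r t
        strict with l t <? l s | r s <? r t
        ... | yes lt<ls | _       = inj₁ lt<ls
        ... | no _      | yes rs<rt = inj₂ rs<rt
        ... | no lt≮ls | no rs≮rt = ⊥-elim (s≢t (toℕ-injective (ℕₚ.≤-antisym
                (key-≤⇒toℕ-≤ t s rs≡rt (sym lt≡ls) rightKey≤)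
                (key-≤⇒toℕ-≤ s t lt≡ls (sym rs≡rt) leftKey≤))))
          where
          lt≡ls : l t ≡ l s
          lt≡ls = ℕₚ.≤-antisym lt≤ls (ℕₚ.≮⇒≥ lt≮ls)
          rs≡rt : r s ≡ r t
          rs≡rt = ℕₚ.≤-antisym rs≤rt (ℕₚ.≮⇒≥ rs≮rt)

    same-block : ∀ {s t} (x : Block s) (y : Block t) → s ≡ t →
      R (proj₁ x) (proj₁ y) ⇔ (leftIn s x , rightIn s x) ⊊ᵢ (leftIn t y , rightIn t y)
    same-block {s} x y refl = mk⇔ (from ∘ Inner.sound s) (Inner.complete s ∘ to)
      where open Equivalence (+-⊊ᵢ⇔ (leftKey s * B) (rightKey s * B))

    leftIn≤rightIn : ∀ s x → leftIn s x ≤ rightIn s x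
    leftIn≤rightIn s x with ℕₚ.m≤n⇒m<n∨m≡n (left≤right s)
    ... | inj₁ l<r =
      ℕₚ.<⇒≤ (lex-< (inner-left<B s x) (key-< {c = l s} s s (left≤right s) (inj₁ l<r) (ℕₚ.<⇒≤ (right<bound s))))
    ... | inj₂ l≡r = begin
      leftKey s * B + Inner.left s x   ≤⟨ ℕₚ.+-monoʳ-≤ (leftKey s * B) (Inner.left≤right s x) ⟩
      leftKey s * B + Inner.right s x  ≡⟨ cong (λ k → k * B + Inner.right s x) keys-equal ⟩
      rightKey s * B + Inner.right s x ∎
      where
      open ℕₚ.≤-Reasoning
      keys-equal : leftKey s ≡ rightKey s
      keys-equal = cong₂ (λ a c → key a c s) l≡r (sym l≡r)

    outer⇔ : ∀ s t → S s t ⇔ (l s , r s) ⊊ᵢ (l t , r t)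
    outer⇔ s t = mk⇔ (IntervalRep.sound outer) (IntervalRep.complete outer)

    left right : Fin n → ℕ
    left x  = leftIn (ρ x) (x , refl)
    right x = rightIn (ρ x) (x , refl)

    represents : ∀ x y → R x y ⇔ (left x , right x) ⊊ᵢ (left y , right y)
    represents x y with ρ x ≟ᶠ ρ y
    ... | yes ρx≡ρy = same-block (x , refl) (y , refl) ρx≡ρy
    ... | no ρx≢ρy  = different-blocks (x , refl) (y , refl) ρx≢ρy ⇔-∘ (outer⇔ (ρ x) (ρ y) ⇔-∘ across ρx≢ρy)

  IntervalRep-substitute : IntervalRep R
  IntervalRep-substitute = record
    { bound       = suc (maxOver right)
    ; left        = left
    ; right       = right
    ; left≤right  = λ x → leftIn≤rightIn (ρ x) (x , refl)
    ; right<bound = λ x → s≤s (≤maxOver right x)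
    ; sound       = λ {x} {y} → Equivalence.to (represents x y)
    ; complete    = λ {x} {y} → Equivalence.from (represents x y)
    }

subsingleton⇒CI : ∀ {A : Set} {R : A → A → Set} → (∀ x → ¬ R x x) → (∀ x y → x ≡ y) → CI R
subsingleton⇒CI {R = R} irrefl all-equal = IntervalRep⇒CI record
  { bound = 1 ; left = λ _ → 0 ; right = λ _ → 0 ; left≤right = λ _ → z≤n ; right<bound = λ _ → s≤s z≤n
  ; sound = λ {x} {y} xRy → ⊥-elim (irrefl x (subst (R x) (sym (all-equal x y)) xRy))
  ; complete = λ { (_ , _ , inj₁ ()) ; (_ , _ , inj₂ ()) }
  }

module _ (P : FinPoset) (dcpt : DuallyCPT (FinPoset._≺_ P)) (connected : ComparabilityConnected P) where
  open FinPoset P using (size; _≺_)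
  open Modules P (CPT-dec (proj₁ dcpt))

  maximal-strong-module-CI : ∀ M → IsMaximalStrongModule P M → CI (Induced P M)
  maximal-strong-module-CI M (M-strong , M≢⊤ , _) with connected⇒module-neighbour connected (proj₁ M-strong) M≢⊤
  ... | y , y∉M , y~M with proj₁ (proj₁ M-strong)
  ...   | a , a∈M with y~M a a∈M
  ...     | inj₂ a≺y = CPT⇒CI-below (proj₁ dcpt) y (λ z z∈M → strong-module-below M-strong y∉M a∈M z∈M a≺y)
  ...     | inj₁ y≺a = CI-dual (CPT⇒CI-below (proj₂ dcpt) y (λ z z∈M → strong-module-above M-strong y∉M a∈M z∈M y≺a))

  private
    module Nontrivial (nontrivial : ∀ (x : X) → ⁅ x ⁆ ≢ ⊤) (Rs : Subset size)
                      (reps : IsQuotientRepresentatives P Rs) where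

      -- Opaque so that the search for a maximal module is never unfolded during type checking.
      opaque
        block : ∀ x → ∃ λ M → IsMaximalStrongModule P M × ⁅ x ⁆ ⊆ M
        block x = strong⇒maximal (⁅⁆-strong x) (nontrivial x)

      Mod : X → Subset size
      Mod x = proj₁ (block x)

      Mod-maximal : ∀ x → IsMaximalStrongModule P (Mod x)
      Mod-maximal x = proj₁ (proj₂ (block x))

      x∈Mod : ∀ x → x ∈ₛ Mod x
      x∈Mod x = proj₂ (proj₂ (block x)) (x∈⁅x⁆ x)

      ρ : X → X
      ρ x = proj₁ (proj₁ (proj₂ reps (Mod x) (Mod-maximal x)))

      ρ∈Rs : ∀ x → ρ x ∈ₛ Rs
      ρ∈Rs x = proj₁ (proj₂ (proj₁ (proj₂ reps (Mod x) (Mod-maximal x))))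

      ρ∈Mod : ∀ x → ρ x ∈ₛ Mod x
      ρ∈Mod x = proj₂ (proj₂ (proj₁ (proj₂ reps (Mod x) (Mod-maximal x))))

      Mod-unique : ∀ {x y} → y ∈ₛ Mod x → Mod y ≡ Mod x
      Mod-unique y∈ = maximal-unique (Mod-maximal _) (Mod-maximal _) (x∈Mod _) y∈

      representative-unique : ∀ {x r r′} → r ∈ₛ Rs → r ∈ₛ Mod x → r′ ∈ₛ Rs → r′ ∈ₛ Mod x → r ≡ r′
      representative-unique {x} = proj₂ (proj₂ reps (Mod x) (Mod-maximal x)) _ _

      ρ-idempotent : ∀ x → ρ (ρ x) ≡ ρ x
      ρ-idempotent x = representative-unique (ρ∈Rs (ρ x)) (ρ∈Mod (ρ x)) (ρ∈Rs x) (x∈Mod (ρ x))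

      ∈Mod-ρ : ∀ {y s} → ρ y ≡ s → y ∈ₛ Mod s
      ∈Mod-ρ {y} refl = subst (y ∈ₛ_) (sym (Mod-unique (ρ∈Mod y))) (x∈Mod y)

      ρ-across : ∀ {x y} → ρ x ≢ ρ y → x ≺ y ⇔ ρ (ρ x) ≺ ρ (ρ y)
      ρ-across {x} {y} ρx≢ρy rewrite ρ-idempotent x | ρ-idempotent y =
        mk⇔ (uniform (x∈Mod x) (ρ∈Mod x) (x∈Mod y) (ρ∈Mod y)) (uniform (ρ∈Mod x) (x∈Mod x) (ρ∈Mod y) (x∈Mod y))
        where
        disjoint : ∀ z → z ∈ₛ Mod x → z ∉ₛ Mod y
        disjoint z z∈Mx z∈My =
          ρx≢ρy (representative-unique (ρ∈Rs x) (subst (ρ x ∈ₛ_) Mx≡My (ρ∈Mod x)) (ρ∈Rs y) (ρ∈Mod y))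
          where
          Mx≡My : Mod x ≡ Mod y
          Mx≡My = trans (sym (Mod-unique z∈Mx)) (Mod-unique z∈My)
        uniform : ∀ {x′ s y′ t} → x′ ∈ₛ Mod x → s ∈ₛ Mod x → y′ ∈ₛ Mod y → t ∈ₛ Mod y → x′ ≺ y′ → s ≺ t
        uniform = strong-modules-uniform (proj₁ (Mod-maximal x)) (proj₁ (Mod-maximal y)) disjoint

      quotient-CI⇒CI : CI (Induced P Rs) → CI _≺_
      quotient-CI⇒CI quotient-CI = IntervalRep⇒CI (IntervalRep-substitute ρ
        (CI⇒IntervalRep (CI-restrict (λ s → ρ s , ρ∈Rs s) quotient-CI))
        (λ s → CI⇒IntervalRep (CI-restrict (λ (y , ρy≡s) → y , ∈Mod-ρ ρy≡s)
                                            (maximal-strong-module-CI (Mod s) (Mod-maximal s))))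
        ρ-across)

  quotient-CI⇒CI : ∀ Rs → IsQuotientRepresentatives P Rs → CI (Induced P Rs) → CI _≺_
  quotient-CI⇒CI Rs reps with any? (λ x → ⁅ x ⁆ ≟⊤)
  ... | no none = Nontrivial.quotient-CI⇒CI (λ x ⁅x⁆≡⊤ → none (x , ⁅x⁆≡⊤)) Rs reps
  ... | yes (x , ⁅x⁆≡⊤) = λ _ → subsingleton⇒CI (FinPoset.irrefl P) (λ y z → trans (≡x y) (sym (≡x z)))
    where
    ≡x : ∀ y → y ≡ x
    ≡x y = x∈⁅y⁆⇒x≡y x (subst (y ∈ₛ_) (sym ⁅x⁆≡⊤) ∈⊤)

theorem6 : (P : FinPoset) → DuallyCPT (FinPoset._≺_ P) → ComparabilityConnected P →
    ((R : Subset (FinPoset.size P)) → IsQuotientRepresentatives P R → DuallyCPT (Induced P R))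
    × ((M : Subset (FinPoset.size P)) → IsMaximalStrongModule P M → CI (Induced P M))
    × ((R : Subset (FinPoset.size P)) → IsQuotientRepresentatives P R → CI (Induced P R) →
         CI (FinPoset._≺_ P))
theorem6 P dcpt connected =
  (λ _ _ → DuallyCPT-restrict proj₁ dcpt) ,
  maximal-strong-module-CI P dcpt connected ,
  quotient-CI⇒CI P dcpt connected
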